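{- Fix $s\in\mathbb{N}$ and let $T$ be a fixed forest with $\alpha_s(T)=k$. Then for all sufficiently large $n\in\mathbb{N}$, there exists a graph $G$ with $|V(G)|\le n$ and treewidth $\mathrm{tw}(G)\le s$ and $C(T,G)\ge (2k)^{ -k}n^k$.
   Context: All graphs are finite, simple and undirected. For graphs $H,G$, $C(H,G)$ denotes the number of subgraphs of $G$ isomorphic to $H$. For a graph $G$ and $s\in\mathbb{N}_0$, $\alpha_s(G)$ is the maximum size of a stable set in the subgraph of $G$ induced by the vertices of degree at most $s$ in $G$. -}

module Defs where

open import Data.Bool using (Bool; true; false)
open import Data.Nat using (ℕ; zero; suc; _+_; _*_; _^_; _≤_)
open import Data.Fin using (Fin; zero; suc; inject₁; fromℕ)
open import Data.Fin.Subset using (Subset; _∈_; ∣_∣)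
open import Data.Vec using (tabulate)
open import Data.Product using (Σ; _×_; _,_; ∃; ∃-syntax)
open import Relation.Binary.PropositionalEquality using (_≡_)
open import Relation.Nullary using (¬_)
open import Data.Unit using (⊤)

record Graph : Set where
  field
    size   : ℕ
    adj    : Fin size → Fin size → Bool
    sym    : ∀ i j → adj i j ≡ adj j i
    irrefl : ∀ i → adj i i ≡ false
open Graph public

Adj : (G : Graph) → Fin (size G) → Fin (size G) → Set
Adj G i j = adj G i j ≡ true

degree : (G : Graph) → Fin (size G) → ℕ
degree G i = ∣ tabulate (adj G i) ∣

-- a cycle of length 3 + k: distinct vertices c 0, …, c (k+2),
-- consecutive ones adjacent, and the last adjacent to the first
record Cycle (G : Graph) (k : ℕ) : Set where
  field
    c      : Fin (suc (suc (suc k))) → Fin (size G)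
    inj    : ∀ a b → c a ≡ c b → a ≡ b
    step   : ∀ (i : Fin (suc (suc k))) → Adj G (c (inject₁ i)) (c (suc i))
    close  : Adj G (c (fromℕ (suc (suc k)))) (c zero)

IsForest : Graph → Set
IsForest G = ∀ k → ¬ Cycle G k

record WalkIn (G : Graph) (P : Fin (size G) → Set) (x y : Fin (size G)) : Set where
  field
    len   : ℕ
    w     : Fin (suc len) → Fin (size G)
    start : w zero ≡ x
    end   : w (fromℕ len) ≡ y
    step  : ∀ (i : Fin len) → Adj G (w (inject₁ i)) (w (suc i))
    inP   : ∀ i → P (w i)

IsConnected : Graph → Set
IsConnected G = ∀ x y → WalkIn G (λ _ → ⊤) x y

IsTree : Graph → Set
IsTree G = (1 ≤ size G) × IsConnected G × IsForest G

record TreeDecomposition (G : Graph) (s : ℕ) : Set₁ where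
  field
    tree     : Graph
    isTree   : IsTree tree
    bag      : Fin (size tree) → Subset (size G)
    coverV   : ∀ v → ∃[ t ] (v ∈ bag t)
    coverE   : ∀ u v → Adj G u v → ∃[ t ] (u ∈ bag t × v ∈ bag t)
    -- the nodes whose bag contains v induce a connected subtree
    coherent : ∀ v x y → v ∈ bag x → v ∈ bag y → WalkIn tree (λ t → v ∈ bag t) x y
    width    : ∀ t → ∣ bag t ∣ ≤ suc s

TreewidthAtMost : Graph → ℕ → Set₁
TreewidthAtMost G s = TreeDecomposition G s

record Subgraph (G : Graph) : Set where
  field
    vs     : Subset (size G)
    es     : Fin (size G) → Fin (size G) → Bool
    es-sym : ∀ u v → es u v ≡ es v u
    es⊆E   : ∀ u v → es u v ≡ true → Adj G u v
    es-end : ∀ u v → es u v ≡ true → u ∈ vs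
open Subgraph public

IsomorphicTo : (H : Graph) {G : Graph} → Subgraph G → Set
IsomorphicTo H {G} S =
  Σ (Fin (size H) → Fin (size G)) λ φ →
      (∀ i j → φ i ≡ φ j → i ≡ j)
    × (∀ i → φ i ∈ vs S)
    × (∀ v → v ∈ vs S → ∃[ i ] (φ i ≡ v))
    × (∀ i j → adj H i j ≡ es S (φ i) (φ j))

SameSubgraph : {G : Graph} → Subgraph G → Subgraph G → Set
SameSubgraph S S′ = (vs S ≡ vs S′) × (∀ u v → es S u v ≡ es S′ u v)

-- C(H,G) ≥ m : there are m pairwise distinct subgraphs of G isomorphic to H
CountAtLeast : ℕ → Graph → Graph → Set
CountAtLeast m H G =
  Σ (Fin m → Subgraph G) λ f →
      (∀ a → IsomorphicTo H (f a))
    × (∀ a b → SameSubgraph (f a) (f b) → a ≡ b)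

StableLowDeg : ℕ → (G : Graph) → Subset (size G) → Set
StableLowDeg s G S =
    (∀ v → v ∈ S → degree G v ≤ s)
  × (∀ u v → u ∈ S → v ∈ S → adj G u v ≡ false)

AlphaIs : ℕ → Graph → ℕ → Set
AlphaIs s G k =
    (∃[ S ] (StableLowDeg s G S × ∣ S ∣ ≡ k))
  × (∀ S → StableLowDeg s G S → ∣ S ∣ ≤ k)

-- Let S be a stable set of k vertices of degree at most s in T.  Replace each vertex of S by c + 1
-- pairwise non-adjacent copies with the same neighbourhood, where c ≈ (n − |T|) / k.  The result has
-- at most n vertices, and choosing one copy of each vertex of S gives (c + 1)^k ≥ (n / 2k)^k
-- distinct copies of T.  Its treewidth is at most s: root the forest T (a nonempty vertex set of a
-- forest always contains a vertex with at most one neighbour in it, so vertices can be stripped off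
-- one by one), give a vertex outside S the bag formed by it and its parent, and give each copy of a
-- vertex a ∈ S the bag formed by it and the at most s neighbours of a, which are never copied since
-- S is stable.  Hanging the copies of a below a, these bags sit on a tree following the rooted forest.

module Submission where

open import Defs hiding (sym)
open import Data.Bool using (Bool; true; false; _∧_; _∨_)
open import Data.Bool.Properties using (∧-comm; ∧-conicalˡ; ∧-conicalʳ; ∨-comm)
open import Data.Fin
  using (Fin; zero; suc; toℕ; fromℕ; fromℕ<; inject₁; _↑ˡ_; _↑ʳ_; splitAt; remQuot; combine;
         funToFin; finToFun)
open import Data.Fin.Properties
  using (_≟_; any?; pigeonhole; ¬∀⟶∃¬-smallest; suc-injective; toℕ<n; toℕ-fromℕ<; toℕ-fromℕ;
         toℕ-inject₁; toℕ-inject; toℕ-injective; splitAt-↑ˡ; splitAt-↑ʳ; splitAt⁻¹-↑ˡ; splitAt⁻¹-↑ʳ;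
         remQuot-combine; combine-remQuot; combine-injectiveʳ; ↑ʳ-injective; funToFin-finToFin)
open import Data.Fin.Subset
  using (Subset; _⊆_; _∈_; _∉_; ∣_∣; _∪_; _∩_; _-_; ⁅_⁆; ⊥; ⊤; inside; outside; Empty)
open import Data.Fin.Subset.Properties
  using (_∈?_; ∈⊤; ∉⊥; x∈⁅x⁆; x∈⁅y⁆⇒x≡y; ∣⁅x⁆∣≡1; ∣⊥∣≡0; ∣⊤∣≡n; p⊆q⇒∣p∣≤∣q∣; nonempty?;
         x∈p∪q⁻; x∈p∪q⁺; x∈p∩q⁺; x∈p∩q⁻; x∈p∧x≢y⇒x∈p-y; x∈p⇒∣p-x∣<∣p∣; p─q⊆p)
open import Data.List using (allFin)
open import Data.List.Extrema.Nat using (argmax; f[xs]≤f[argmax])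
open import Data.List.Membership.Propositional.Properties using (∈-allFin)
import Data.List.Relation.Unary.All as All
open import Data.Maybe using (Maybe; just; nothing; maybe′)
open import Data.Nat using (ℕ; zero; suc; _+_; _*_; _^_; _∸_; _≤_; _<_; _≤?_; z≤n; s≤s; s≤s⁻¹)
open import Data.Nat.DivMod using (_/_; _%_; m/n*n≤m; m≡m%n+[m/n]*n; m%n<n)
open import Data.Nat.Properties
  using (≤-refl; ≤-reflexive; ≤-trans; <-irrefl; <-≤-trans; <⇒≤; ≰⇒>; ≤-pred; n<1+n; n≤1+n;
         m≤n⇒m≤1+n; <-cmp; +-identityʳ; +-suc; +-monoʳ-≤; +-monoˡ-≤; +-mono-≤; +-monoˡ-<;
         m∸n+n≡m; m+[n∸m]≡n; m+n≤o⇒m≤o; m+n≤o⇒m≤o∸n; *-comm; *-distribˡ-+;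
         [m*n]*[o*p]≡[m*o]*[n*p]; ^-monoˡ-≤; module ≤-Reasoning)
open import Data.Product using (Σ-syntax; _×_; _,_; proj₁; proj₂; uncurry; ∃-syntax; ∃₂)
open import Data.Sum using (_⊎_; inj₁; inj₂; [_,_]′) renaming (map to map-⊎)
open import Data.Unit using (tt) renaming (⊤ to Unit)
open import Data.Vec using ([]; _∷_; tabulate; _++_; here; there)
open import Data.Vec.Functional using (updateAt)
open import Data.Vec.Functional.Properties using (updateAt-updates; updateAt-minimal)
open import Data.Vec.Properties using (lookup∘tabulate; []=⇒lookup; lookup⇒[]=)
open import Function using (_∘_; id; const)
open import Relation.Binary.Definitions using (tri<; tri≈; tri>)
open import Relation.Binary.PropositionalEquality
  using (_≡_; _≢_; _≗_; refl; sym; trans; cong; cong₂; subst; subst₂; module ≡-Reasoning)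
open import Relation.Nullary using (¬_; Dec; does; yes; no; ¬?; contradiction)
open import Relation.Nullary.Decidable using (_×-dec_; decidable-stable; dec-true)
open import Relation.Unary using (Decidable)

-- Subsets of a finite set

∈-tabulate⁺ : ∀ {n} {f : Fin n → Bool} {i} → f i ≡ true → i ∈ tabulate f
∈-tabulate⁺ {f = f} {i} fi = lookup⇒[]= i (tabulate f) (trans (lookup∘tabulate f i) fi)

∈-tabulate⁻ : ∀ {n} {f : Fin n → Bool} {i} → i ∈ tabulate f → f i ≡ true
∈-tabulate⁻ {f = f} {i} i∈f = trans (sym (lookup∘tabulate f i)) ([]=⇒lookup i∈f)

∣p∪q∣≤∣p∣+∣q∣ : ∀ {n} (p q : Subset n) → ∣ p ∪ q ∣ ≤ ∣ p ∣ + ∣ q ∣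
∣p∪q∣≤∣p∣+∣q∣ [] [] = z≤n
∣p∪q∣≤∣p∣+∣q∣ (inside ∷ p) (inside ∷ q) =
  s≤s (≤-trans (∣p∪q∣≤∣p∣+∣q∣ p q) (+-monoʳ-≤ ∣ p ∣ (n≤1+n ∣ q ∣)))
∣p∪q∣≤∣p∣+∣q∣ (inside ∷ p) (outside ∷ q) = s≤s (∣p∪q∣≤∣p∣+∣q∣ p q)
∣p∪q∣≤∣p∣+∣q∣ (outside ∷ p) (inside ∷ q) =
  ≤-trans (s≤s (∣p∪q∣≤∣p∣+∣q∣ p q)) (≤-reflexive (sym (+-suc ∣ p ∣ ∣ q ∣)))
∣p∪q∣≤∣p∣+∣q∣ (outside ∷ p) (outside ∷ q) = ∣p∪q∣≤∣p∣+∣q∣ p q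

∣p++q∣≡∣p∣+∣q∣ : ∀ {m n} (p : Subset m) (q : Subset n) → ∣ p ++ q ∣ ≡ ∣ p ∣ + ∣ q ∣
∣p++q∣≡∣p∣+∣q∣ [] q = refl
∣p++q∣≡∣p∣+∣q∣ (inside ∷ p) q = cong suc (∣p++q∣≡∣p∣+∣q∣ p q)
∣p++q∣≡∣p∣+∣q∣ (outside ∷ p) q = ∣p++q∣≡∣p∣+∣q∣ p q

∈-++⁺ˡ : ∀ {m n} {p : Subset m} {x} (q : Subset n) → x ∈ p → x ↑ˡ n ∈ p ++ q
∈-++⁺ˡ q here = here
∈-++⁺ˡ q (there x∈p) = there (∈-++⁺ˡ q x∈p)

∈-++⁻ˡ : ∀ {m n} (p : Subset m) {q : Subset n} {x} → x ↑ˡ n ∈ p ++ q → x ∈ p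
∈-++⁻ˡ (_ ∷ p) {x = zero} here = here
∈-++⁻ˡ (_ ∷ p) {x = suc x} (there x∈p++q) = there (∈-++⁻ˡ p x∈p++q)

↑ʳ∉p++⊥ : ∀ {m n} (p : Subset m) (y : Fin n) → m ↑ʳ y ∉ p ++ ⊥
↑ʳ∉p++⊥ [] (suc y) (there y∈⊥) = ↑ʳ∉p++⊥ [] y y∈⊥
↑ʳ∉p++⊥ (_ ∷ p) y (there y∈p++⊥) = ↑ʳ∉p++⊥ p y y∈p++⊥

x∉p-x : ∀ {n} {p : Subset n} {x} → x ∉ p - x
x∉p-x {p = _ ∷ p} {suc x} (there x∈p-x) = x∉p-x {p = p} x∈p-x

x∈p⇒1≤∣p∣ : ∀ {n} {p : Subset n} {x} → x ∈ p → 1 ≤ ∣ p ∣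
x∈p⇒1≤∣p∣ {x = x} x∈p =
  subst (_≤ _) (∣⁅x⁆∣≡1 x) (p⊆q⇒∣p∣≤∣q∣ (λ y∈⁅x⁆ → subst (_∈ _) (sym (x∈⁅y⁆⇒x≡y x y∈⁅x⁆)) x∈p))

x≢y⇒2≤∣p∣ : ∀ {n} {p : Subset n} {x y} → x ∈ p → y ∈ p → x ≢ y → 2 ≤ ∣ p ∣
x≢y⇒2≤∣p∣ x∈p y∈p x≢y =
  ≤-trans (s≤s (x∈p⇒1≤∣p∣ (x∈p∧x≢y⇒x∈p-y y∈p (λ y≡x → x≢y (sym y≡x))))) (x∈p⇒∣p-x∣<∣p∣ x∈p)

2≤∣p∣⇒∃≢ : ∀ {n} {p : Subset n} → 2 ≤ ∣ p ∣ → ∀ z → ∃[ y ] (y ∈ p × y ≢ z)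
2≤∣p∣⇒∃≢ {p = p} 2≤∣p∣ z with any? (λ y → y ∈? p ×-dec ¬? (y ≟ z))
... | yes found = found
... | no none = contradiction (≤-trans 2≤∣p∣ ∣p∣≤1) λ { (s≤s ()) }
  where
  p⊆⁅z⁆ : p ⊆ ⁅ z ⁆
  p⊆⁅z⁆ {y} y∈p with y ≟ z
  ... | yes refl = x∈⁅x⁆ z
  ... | no y≢z = contradiction (y , y∈p , y≢z) none
  ∣p∣≤1 : ∣ p ∣ ≤ 1
  ∣p∣≤1 = subst (∣ p ∣ ≤_) (∣⁅x⁆∣≡1 z) (p⊆q⇒∣p∣≤∣q∣ p⊆⁅z⁆)

∣p∣≤1⇒unique : ∀ {n} {p : Subset n} {x y} → ∣ p ∣ ≤ 1 → x ∈ p → y ∈ p → x ≡ y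
∣p∣≤1⇒unique {x = x} {y} ∣p∣≤1 x∈p y∈p with x ≟ y
... | yes x≡y = x≡y
... | no x≢y = contradiction (≤-trans (x≢y⇒2≤∣p∣ x∈p y∈p x≢y) ∣p∣≤1) λ { (s≤s ()) }

∣p∣≤1⇒Maybe : ∀ {n} {p : Subset n} → ∣ p ∣ ≤ 1 →
  ∃[ m ] ((∀ {y} → m ≡ just y → y ∈ p) × (∀ {y} → y ∈ p → m ≡ just y))
∣p∣≤1⇒Maybe {p = p} ∣p∣≤1 with nonempty? p
... | yes (x , x∈p) = just x , (λ { refl → x∈p }) , λ y∈p → cong just (∣p∣≤1⇒unique ∣p∣≤1 x∈p y∈p)
... | no empty = nothing , (λ ()) , λ y∈p → contradiction (_ , y∈p) empty

-- Paths and cycles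

Adj-sym : ∀ (G : Graph) {x y} → Adj G x y → Adj G y x
Adj-sym G {x} {y} xy = trans (Graph.sym G y x) xy

Adj-irrefl : ∀ (G : Graph) {x} → ¬ Adj G x x
Adj-irrefl G {x} xx with () ← trans (sym xx) (irrefl G x)

nbhd : (G : Graph) → Fin (size G) → Subset (size G)
nbhd G x = tabulate (adj G x)

infixr 5 _∷⟨_⟩_

data Path (G : Graph) (P : Fin (size G) → Set) : Fin (size G) → Fin (size G) → Set where
  [_]    : ∀ {x} → P x → Path G P x x
  _∷⟨_⟩_ : ∀ {x y z} → P x → Adj G x y → Path G P y z → Path G P x z

module _ {G : Graph} {P : Fin (size G) → Set} where

  head : ∀ {x y} → Path G P x y → P x
  head [ px ] = px
  head (px ∷⟨ _ ⟩ _) = px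

  infixr 5 _++ₚ_

  _++ₚ_ : ∀ {x y z} → Path G P x y → Path G P y z → Path G P x z
  [ _ ] ++ₚ q = q
  (px ∷⟨ xy ⟩ p) ++ₚ q = px ∷⟨ xy ⟩ (p ++ₚ q)

  reverse : ∀ {x y} → Path G P x y → Path G P y x
  reverse [ px ] = [ px ]
  reverse (px ∷⟨ xy ⟩ p) = reverse p ++ₚ (head p ∷⟨ Adj-sym G xy ⟩ [ px ])

  toWalkIn : ∀ {x y} → Path G P x y → WalkIn G P x y
  toWalkIn {x} [ px ] =
    record { len = 0 ; w = const x ; start = refl ; end = refl ; step = λ () ; inP = const px }
  toWalkIn {x} (px ∷⟨ xy ⟩ p) = record
    { len = suc len ; w = w′ ; start = refl ; end = end ; step = step′ ; inP = inP′ }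
    where
    open WalkIn (toWalkIn p)
    w′ : Fin (suc (suc len)) → Fin (size G)
    w′ zero = x
    w′ (suc i) = w i
    step′ : ∀ i → Adj G (w′ (inject₁ i)) (w′ (suc i))
    step′ zero = subst (Adj G x) (sym start) xy
    step′ (suc i) = step i
    inP′ : ∀ i → P (w′ i)
    inP′ zero = px
    inP′ (suc i) = inP i

fromℕ⊎inject₁ : ∀ {m} (i : Fin (suc m)) → i ≡ fromℕ m ⊎ ∃[ j ] i ≡ inject₁ j
fromℕ⊎inject₁ {zero} zero = inj₁ refl
fromℕ⊎inject₁ {suc m} zero = inj₂ (zero , refl)
fromℕ⊎inject₁ {suc m} (suc i) with fromℕ⊎inject₁ i
... | inj₁ refl = inj₁ refl
... | inj₂ (j , refl) = inj₂ (suc j , refl)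

cycle-neighbours : ∀ {G k} (C : Cycle G k) i → let open Cycle C in
  ∃₂ λ j j′ → j ≢ j′ × Adj G (c i) (c j) × Adj G (c i) (c j′)
cycle-neighbours {G} C zero = suc zero , _ , (λ ()) , step zero , Adj-sym G close
  where open Cycle C
cycle-neighbours {G} C (suc i) with fromℕ⊎inject₁ i
... | inj₁ refl = _ , zero , (λ ()) , Adj-sym G (step i) , close
  where open Cycle C
... | inj₂ (j , refl) = _ , _ , distinct , Adj-sym G (step (inject₁ j)) , step (suc j)
  where
  open Cycle C
  distinct : inject₁ (inject₁ j) ≢ suc (suc j)
  distinct eq = <-irrefl j≡2+j (m≤n⇒m≤1+n (n<1+n (toℕ j)))
    where
    j≡2+j : toℕ j ≡ suc (suc (toℕ j))
    j≡2+j = trans (sym (trans (toℕ-inject₁ (inject₁ j)) (toℕ-inject₁ j))) (cong toℕ eq)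

least : ∀ {P : ℕ → Set} → Decidable P → ∀ {b} → P b → ∃[ m ] (P m × ∀ {c} → c < m → ¬ P c)
least {P} P? {b} Pb with ¬∀⟶∃¬-smallest (suc b) (¬_ ∘ P ∘ toℕ) (¬? ∘ P? ∘ toℕ)
                          (λ ∀¬P → ∀¬P (fromℕ b) (subst P (sym (toℕ-fromℕ b)) Pb))
... | m , ¬¬Pm , below = toℕ m , decidable-stable (P? (toℕ m)) ¬¬Pm , λ c<m →
  subst (¬_ ∘ P) (trans (toℕ-inject (fromℕ< c<m)) (toℕ-fromℕ< c<m)) (below (fromℕ< c<m))

module _ {G : Graph} (w : ℕ → Fin (size G))
         (w-adj : ∀ i → Adj G (w i) (w (suc i)))
         (w-nonBacktracking : ∀ i → w (suc (suc i)) ≢ w i) where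

  -- Indices are added on the left so that suc i + a reduces to suc (i + a).
  segmentCycle : ∀ a k → w (suc (suc (suc k)) + a) ≡ w a →
    (∀ {i j} → i < j → j < suc (suc (suc k)) + a → w i ≢ w j) → Cycle G k
  segmentCycle a k closes distinct = record { c = c ; inj = inj ; step = step ; close = close }
    where
    c : Fin (suc (suc (suc k))) → Fin (size G)
    c i = w (toℕ i + a)
    inj : ∀ i j → c i ≡ c j → i ≡ j
    inj i j ci≡cj with <-cmp (toℕ i) (toℕ j)
    ... | tri< i<j _ _ = contradiction ci≡cj (distinct (+-monoˡ-< a i<j) (+-monoˡ-< a (toℕ<n j)))
    ... | tri≈ _ i≡j _ = toℕ-injective i≡j
    ... | tri> _ _ j<i = contradiction (sym ci≡cj) (distinct (+-monoˡ-< a j<i) (+-monoˡ-< a (toℕ<n i)))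
    step : ∀ i → Adj G (c (inject₁ i)) (c (suc i))
    step i rewrite toℕ-inject₁ i = w-adj (toℕ i + a)
    close : Adj G (c (fromℕ (suc (suc k)))) (c zero)
    close rewrite toℕ-fromℕ k = subst (Adj G _) closes (w-adj (suc (suc k) + a))

  private
    Repeat : ℕ → Set
    Repeat b = ∃[ i ] w (toℕ {b} i) ≡ w b

    repeatAt : ∀ {i j} → i < j → w i ≡ w j → Repeat j
    repeatAt i<j wi≡wj = fromℕ< i<j , subst (λ x → w x ≡ _) (sym (toℕ-fromℕ< i<j)) wi≡wj

    repeat⇒Cycle : ∀ {a b} → a < b → w a ≡ w b → (∀ {c} → c < b → ¬ Repeat c) → ∃[ k ] Cycle G k
    repeat⇒Cycle {a} {b} a<b wa≡wb first with b ∸ a | m∸n+n≡m (<⇒≤ a<b)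
    ... | zero | refl = contradiction a<b (<-irrefl refl)
    ... | suc zero | refl = contradiction (subst (Adj G _) (sym wa≡wb) (w-adj a)) (Adj-irrefl G)
    ... | suc (suc zero) | refl = contradiction (sym wa≡wb) (w-nonBacktracking a)
    ... | suc (suc (suc k)) | refl = k , segmentCycle a k (sym wa≡wb) distinct
      where
      distinct : ∀ {i j} → i < j → j < suc (suc (suc k)) + a → w i ≢ w j
      distinct i<j j<b wi≡wj = first j<b (repeatAt i<j wi≡wj)

  -- The first repetition of a vertex closes a cycle, of length at least 3 because the walk never
  -- stays put or turns back.
  nonBacktracking⇒Cycle : ∃[ k ] Cycle G k
  nonBacktracking⇒Cycle with pigeonhole (n<1+n (size G)) (w ∘ toℕ)
  ... | i , j , i<j , wi≡wj with least (λ b → any? (λ i → w (toℕ i) ≟ w b)) (repeatAt i<j wi≡wj)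
  ... | b , (a , wa≡wb) , first = repeat⇒Cycle (toℕ<n a) wa≡wb first

-- Rooting a forest

module _ {T : Graph} (forest : IsForest T) where

  private
    t : ℕ
    t = size T

  forest⇒leaf : ∀ {A : Subset t} {x} → x ∈ A → ∃[ y ] (y ∈ A × ∣ A ∩ nbhd T y ∣ ≤ 1)
  forest⇒leaf {A} {x₀} x₀∈A with any? (λ y → y ∈? A ×-dec ∣ A ∩ nbhd T y ∣ ≤? 1)
  ... | yes leaf = leaf
  ... | no noLeaf = contradiction (proj₂ cycle) (forest _)
    where
    branching : ∀ {y} → y ∈ A → ∀ z → ∃[ y′ ] (y′ ∈ A × Adj T y y′ × y′ ≢ z)
    branching {y} y∈A z with 2≤∣p∣⇒∃≢ (≰⇒> (λ leaf → noLeaf (y , y∈A , leaf))) z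
    ... | y′ , y′∈A∩N , y′≢z =
      y′ , proj₁ (x∈p∩q⁻ A _ y′∈A∩N) , ∈-tabulate⁻ (proj₂ (x∈p∩q⁻ A _ y′∈A∩N)) , y′≢z

    Step : Set
    Step = Σ[ (x , y) ∈ Fin t × Fin t ] (y ∈ A × Adj T x y)

    advance : Step → Step
    advance ((x , y) , y∈A , _) = (y , y′) , y′∈A , yy′
      where
      y′ = proj₁ (branching y∈A x)
      y′∈A = proj₁ (proj₂ (branching y∈A x))
      yy′ = proj₁ (proj₂ (proj₂ (branching y∈A x)))

    steps : ℕ → Step
    steps zero = (x₀ , proj₁ b) , proj₁ (proj₂ b) , proj₁ (proj₂ (proj₂ b))
      where b = branching x₀∈A x₀
    steps (suc n) = advance (steps n)

    w : ℕ → Fin t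
    w n = proj₁ (proj₁ (steps n))

    cycle : ∃[ k ] Cycle T k
    cycle = nonBacktracking⇒Cycle w (λ n → proj₂ (proj₂ (steps n)))
      (λ n → proj₂ (proj₂ (proj₂ (branching (proj₁ (proj₂ (steps n))) (w n)))))

record Rooting (T : Graph) (A : Subset (size T)) (h : ℕ) : Set where
  field
    parent      : Fin (size T) → Maybe (Fin (size T))
    rank        : Fin (size T) → ℕ
    parent-∈    : ∀ {x y} → x ∈ A → parent x ≡ just y → y ∈ A
    parent-rank : ∀ {x y} → x ∈ A → parent x ≡ just y → rank y < rank x
    rank<h      : ∀ {x} → x ∈ A → rank x < h
    edge-parent : ∀ {x y} → x ∈ A → y ∈ A → Adj T x y → parent x ≡ just y ⊎ parent y ≡ just x

emptyRooting : ∀ {T A h} → Empty A → Rooting T A h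
emptyRooting {A = A} empty = record
  { parent = const nothing ; rank = const 0
  ; parent-∈ = λ x∈A _ → absurd x∈A ; parent-rank = λ x∈A _ → absurd x∈A
  ; rank<h = absurd ; edge-parent = λ x∈A _ _ → absurd x∈A }
  where
  absurd : ∀ {B : Set} {x} → x ∈ A → B
  absurd x∈A = contradiction (_ , x∈A) empty

-- A leaf x₀ of A is attached to its neighbour in A, if any, and gets the largest rank.
module _ {T : Graph} {A : Subset (size T)} {x₀ h} (x₀∈A : x₀ ∈ A) (leaf : ∣ A ∩ nbhd T x₀ ∣ ≤ 1)
         (R : Rooting T (A - x₀) h) where

  private
    module R = Rooting R
    up : Maybe (Fin (size T))
    up = proj₁ (∣p∣≤1⇒Maybe {p = A ∩ nbhd T x₀} leaf)

    up-∈ : ∀ {y} → up ≡ just y → y ∈ A ∩ nbhd T x₀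
    up-∈ = proj₁ (proj₂ (∣p∣≤1⇒Maybe {p = A ∩ nbhd T x₀} leaf))

    up-complete : ∀ {y} → y ∈ A ∩ nbhd T x₀ → up ≡ just y
    up-complete = proj₂ (proj₂ (∣p∣≤1⇒Maybe {p = A ∩ nbhd T x₀} leaf))

    parent : Fin (size T) → Maybe (Fin (size T))
    parent = updateAt R.parent x₀ (const up)

    rank : Fin (size T) → ℕ
    rank = updateAt R.rank x₀ (const h)

    ∈-≢ : ∀ {x} → x ∈ A - x₀ → x ≢ x₀
    ∈-≢ x∈A′ refl = x∉p-x x∈A′

    split : ∀ {x} → x ∈ A → x ≡ x₀ ⊎ x ∈ A - x₀
    split {x} x∈A with x ≟ x₀
    ... | yes x≡x₀ = inj₁ x≡x₀
    ... | no x≢x₀ = inj₂ (x∈p∧x≢y⇒x∈p-y x∈A x≢x₀)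

    parent-≢ : ∀ {x} → x ∈ A - x₀ → parent x ≡ R.parent x
    parent-≢ x∈A′ = updateAt-minimal _ x₀ R.parent (∈-≢ x∈A′)

    rank-≢ : ∀ {x} → x ∈ A - x₀ → rank x ≡ R.rank x
    rank-≢ x∈A′ = updateAt-minimal _ x₀ R.rank (∈-≢ x∈A′)

    up-edge : ∀ {y} → y ∈ A → Adj T x₀ y → parent x₀ ≡ just y
    up-edge y∈A x₀y =
      trans (updateAt-updates x₀ R.parent) (up-complete (x∈p∩q⁺ (y∈A , ∈-tabulate⁺ x₀y)))

    parent-∈′ : ∀ {x y} → x ∈ A → parent x ≡ just y → y ∈ A - x₀
    parent-∈′ x∈A px≡y with split x∈A
    ... | inj₁ refl = x∈p∧x≢y⇒x∈p-y y∈A λ { refl → Adj-irrefl T x₀y }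
      where
      y∈A∩N = up-∈ (trans (sym (updateAt-updates x₀ R.parent)) px≡y)
      y∈A = proj₁ (x∈p∩q⁻ A _ y∈A∩N)
      x₀y = ∈-tabulate⁻ (proj₂ (x∈p∩q⁻ A _ y∈A∩N))
    ... | inj₂ x∈A′ = R.parent-∈ x∈A′ (trans (sym (parent-≢ x∈A′)) px≡y)

    parent-rank : ∀ {x y} → x ∈ A → parent x ≡ just y → rank y < rank x
    parent-rank {x} {y} x∈A px≡y =
      subst (_< rank x) (sym (rank-≢ y∈A′)) (R-rank<rank (split x∈A))
      where
      y∈A′ = parent-∈′ x∈A px≡y
      R-rank<rank : x ≡ x₀ ⊎ x ∈ A - x₀ → R.rank y < rank x
      R-rank<rank (inj₁ refl) =
        subst (R.rank y <_) (sym (updateAt-updates x₀ R.rank)) (R.rank<h y∈A′)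
      R-rank<rank (inj₂ x∈A′) =
        subst (R.rank y <_) (sym (rank-≢ x∈A′)) (R.parent-rank x∈A′ (trans (sym (parent-≢ x∈A′)) px≡y))

    rank<1+h : ∀ {x} → x ∈ A → rank x < suc h
    rank<1+h x∈A with split x∈A
    ... | inj₁ refl = subst (_< suc h) (sym (updateAt-updates x₀ R.rank)) (n<1+n h)
    ... | inj₂ x∈A′ = subst (_< suc h) (sym (rank-≢ x∈A′)) (m≤n⇒m≤1+n (R.rank<h x∈A′))

    edge-parent : ∀ {x y} → x ∈ A → y ∈ A → Adj T x y → parent x ≡ just y ⊎ parent y ≡ just x
    edge-parent x∈A y∈A xy with split x∈A | split y∈A
    ... | inj₁ refl | _ = inj₁ (up-edge y∈A xy)
    ... | inj₂ _ | inj₁ refl = inj₂ (up-edge x∈A (Adj-sym T xy))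
    ... | inj₂ x∈A′ | inj₂ y∈A′ with R.edge-parent x∈A′ y∈A′ xy
    ...   | inj₁ px≡y = inj₁ (trans (parent-≢ x∈A′) px≡y)
    ...   | inj₂ py≡x = inj₂ (trans (parent-≢ y∈A′) py≡x)

  extendRooting : Rooting T A (suc h)
  extendRooting = record
    { parent = parent ; rank = rank
    ; parent-∈ = λ x∈A px≡y → p─q⊆p A _ (parent-∈′ x∈A px≡y)
    ; parent-rank = parent-rank ; rank<h = rank<1+h ; edge-parent = edge-parent }

rooting : ∀ {T} → IsForest T → ∀ h (A : Subset (size T)) → ∣ A ∣ ≤ h → Rooting T A h
rooting forest zero A ∣A∣≤0 =
  emptyRooting λ (_ , x∈A) → contradiction (≤-trans (x∈p⇒1≤∣p∣ x∈A) ∣A∣≤0) λ ()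
rooting forest (suc h) A ∣A∣≤1+h with nonempty? A
... | no empty = emptyRooting empty
... | yes (_ , x∈A) with forest⇒leaf forest x∈A
... | x₀ , x₀∈A , leaf = extendRooting x₀∈A leaf
  (rooting forest h (A - x₀) (≤-pred (≤-trans (x∈p⇒∣p-x∣<∣p∣ x₀∈A) ∣A∣≤1+h)))

-- Trees given by a parent function, and tree decompositions with star-shaped bags

-- Opaque: unfolding the maximiser during the with-abstraction in tree-forest makes checking blow up.
opaque
  argmax-exists : ∀ {n} (f : Fin (suc n) → ℕ) → ∃[ i ] (∀ j → f j ≤ f i)
  argmax-exists f =
    argmax f zero (allFin _) , λ j → All.lookup (f[xs]≤f[argmax] {f = f} zero (allFin _)) (∈-allFin j)

module ParentTree {N : ℕ} (parent : Fin N → Fin (suc N)) (rank : Fin (suc N) → ℕ)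
                  (parent-rank : ∀ p → rank (parent p) < rank (suc p)) where

  isChildOf : Fin (suc N) → Fin (suc N) → Bool
  isChildOf zero b = false
  isChildOf (suc p) b = does (parent p ≟ b)

  isChildOf-irrefl : ∀ a → isChildOf a a ≡ false
  isChildOf-irrefl zero = refl
  isChildOf-irrefl (suc p) with parent p ≟ suc p
  ... | yes p↑≡p = contradiction (parent-rank p) (<-irrefl (cong rank p↑≡p))
  ... | no _ = refl

  isChildOf⇒parent : ∀ {a b} → isChildOf a b ≡ true → ∃[ p ] (a ≡ suc p × parent p ≡ b)
  isChildOf⇒parent {suc p} {b} _ with parent p ≟ b
  ... | yes p↑≡b = p , refl , p↑≡b

  tree : Graph
  tree = record
    { size = suc N
    ; adj = λ a b → isChildOf a b ∨ isChildOf b a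
    ; sym = λ a b → ∨-comm (isChildOf a b) (isChildOf b a)
    ; irrefl = λ a → cong (λ b → b ∨ b) (isChildOf-irrefl a) }

  parent-adj : ∀ {p b} → parent p ≡ b → Adj tree (suc p) b
  parent-adj {p} refl = cong (_∨ isChildOf (parent p) (suc p)) (dec-true (parent p ≟ parent p) refl)

  adj⇒parent : ∀ {a b} → Adj tree a b →
    ∃[ p ] (a ≡ suc p × parent p ≡ b) ⊎ ∃[ p ] (b ≡ suc p × parent p ≡ a)
  adj⇒parent {a} {b} ab with isChildOf a b in ab-child
  ... | true = inj₁ (isChildOf⇒parent ab-child)
  ... | false = inj₂ (isChildOf⇒parent ab)

  pathToRoot : ∀ a → Path tree (const Unit) a zero
  pathToRoot a = go (suc (rank a)) a (s≤s ≤-refl)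
    where
    go : ∀ n a → rank a < n → Path tree (const Unit) a zero
    go (suc n) zero _ = [ tt ]
    go (suc n) (suc p) r =
      tt ∷⟨ parent-adj refl ⟩ go n (parent p) (<-≤-trans (parent-rank p) (s≤s⁻¹ r))

  -- On a cycle, both neighbours of a vertex of maximal rank would be its parent.
  tree-forest : IsForest tree
  tree-forest k C with argmax-exists (rank ∘ Cycle.c C)
  ... | top , top-max = sameParent (cycle-neighbours C top)
    where
    open Cycle C
    open ≡-Reasoning

    toParent : ∀ {i} → Adj tree (c top) (c i) → ∃[ p ] (c top ≡ suc p × parent p ≡ c i)
    toParent {i} top-i with adj⇒parent top-i
    ... | inj₁ up = up
    ... | inj₂ (p , ci≡p , p↑≡top) = contradiction (<-≤-trans top<i (top-max i)) (<-irrefl refl)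
      where
      top<i : rank (c top) < rank (c i)
      top<i = subst₂ (λ x y → rank x < rank y) p↑≡top (sym ci≡p) (parent-rank p)

    sameParent : ¬ (∃₂ λ j j′ → j ≢ j′ × Adj tree (c top) (c j) × Adj tree (c top) (c j′))
    sameParent (j , j′ , j≢j′ , top-j , top-j′) with toParent top-j | toParent top-j′
    ... | p , top≡p , p↑≡j | p′ , top≡p′ , p′↑≡j′ = j≢j′ (inj j j′ (begin
      c j         ≡⟨ sym p↑≡j ⟩
      parent p    ≡⟨ cong parent (suc-injective (trans (sym top≡p) top≡p′)) ⟩
      parent p′   ≡⟨ p′↑≡j′ ⟩
      c j′        ∎))

  tree-isTree : IsTree tree
  tree-isTree = s≤s z≤n , (λ x y → toWalkIn (pathToRoot x ++ₚ reverse (pathToRoot y))) , tree-forest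

starBag : ∀ {N} → (Fin N → Subset N) → Fin (suc N) → Subset N
starBag B zero = ⊥
starBag B (suc u) = ⁅ u ⁆ ∪ B u

centre∈starBag : ∀ {N} (B : Fin N → Subset N) u → u ∈ starBag B (suc u)
centre∈starBag B u = x∈p∪q⁺ (inj₁ (x∈⁅x⁆ u))

extra∈starBag : ∀ {N} (B : Fin N → Subset N) {u v} → v ∈ B u → v ∈ starBag B (suc u)
extra∈starBag B v∈Bu = x∈p∪q⁺ (inj₂ v∈Bu)

InStarBag : ∀ {N} → (Fin N → Subset N) → Fin N → Fin (suc N) → Set
InStarBag B v n = v ∈ starBag B n

module _ {G : Graph} {s : ℕ}
         (parent : Fin (size G) → Fin (suc (size G))) (rank : Fin (suc (size G)) → ℕ)
         (parent-rank : ∀ p → rank (parent p) < rank (suc p))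
         (B : Fin (size G) → Subset (size G)) where

  open ParentTree parent rank parent-rank

  starDecomposition :
    (∀ u → ∣ B u ∣ ≤ s) →
    (∀ {u v} → Adj G u v → v ∈ B u ⊎ u ∈ B v) →
    (∀ {u v} → v ∈ B u → Path tree (InStarBag B v) (suc u) (suc v)) →
    TreeDecomposition G s
  starDecomposition B-size B-edge B-path = record
    { tree = tree ; isTree = tree-isTree ; bag = starBag B
    ; coverV = λ v → suc v , centre v
    ; coverE = coverE
    ; coherent = λ v x y vx vy → toWalkIn (toCentre vx ++ₚ reverse (toCentre vy))
    ; width = width }
    where
    centre : ∀ u → u ∈ starBag B (suc u)
    centre = centre∈starBag B

    leaf : ∀ {u v} → v ∈ B u → v ∈ starBag B (suc u)
    leaf = extra∈starBag B

    coverE : ∀ u v → Adj G u v → ∃[ n ] (u ∈ starBag B n × v ∈ starBag B n)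
    coverE u v uv with B-edge uv
    ... | inj₁ v∈Bu = suc u , centre u , leaf v∈Bu
    ... | inj₂ u∈Bv = suc v , leaf u∈Bv , centre v

    toCentre : ∀ {v n} → v ∈ starBag B n → Path tree (InStarBag B v) n (suc v)
    toCentre {n = zero} v∈⊥ = contradiction v∈⊥ ∉⊥
    toCentre {v} {suc u} v∈bag with x∈p∪q⁻ ⁅ u ⁆ (B u) v∈bag
    ... | inj₁ v∈⁅u⁆ rewrite x∈⁅y⁆⇒x≡y u v∈⁅u⁆ = [ v∈bag ]
    ... | inj₂ v∈Bu = B-path v∈Bu

    width : ∀ n → ∣ starBag B n ∣ ≤ suc s
    width zero = subst (_≤ suc s) (sym (∣⊥∣≡0 (size G))) z≤n
    width (suc u) = ≤-trans (∣p∪q∣≤∣p∣+∣q∣ ⁅ u ⁆ (B u))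
                            (subst (λ m → m + ∣ B u ∣ ≤ suc s) (sym (∣⁅x⁆∣≡1 u)) (s≤s (B-size u)))

-- Copies of T in a graph pulled back along a map onto T

does⇒ : ∀ {A : Set} (A? : Dec A) → does A? ≡ true → A
does⇒ (yes a) _ = a

enumerate : ∀ {n} (p : Subset n) → Fin ∣ p ∣ → Fin n
enumerate (inside ∷ p) zero = zero
enumerate (inside ∷ p) (suc i) = suc (enumerate p i)
enumerate (outside ∷ p) i = suc (enumerate p i)

enumerate-∈ : ∀ {n} (p : Subset n) i → enumerate p i ∈ p
enumerate-∈ (inside ∷ p) zero = here
enumerate-∈ (inside ∷ p) (suc i) = there (enumerate-∈ p i)
enumerate-∈ (outside ∷ p) i = there (enumerate-∈ p i)

enumerate-injective : ∀ {n} (p : Subset n) {i j} → enumerate p i ≡ enumerate p j → i ≡ j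
enumerate-injective (inside ∷ p) {zero} {zero} _ = refl
enumerate-injective (inside ∷ p) {suc i} {suc j} eq = cong suc (enumerate-injective p (suc-injective eq))
enumerate-injective (outside ∷ p) eq = enumerate-injective p (suc-injective eq)

funToFin-cong : ∀ {m n} {f g : Fin m → Fin n} → f ≗ g → funToFin f ≡ funToFin g
funToFin-cong {zero} _ = refl
funToFin-cong {suc m} f≗g = cong₂ combine (f≗g zero) (funToFin-cong (f≗g ∘ suc))

finToFun-injective : ∀ {m n} (i j : Fin (m ^ n)) → finToFun {m} {n} i ≗ finToFun j → i ≡ j
finToFun-injective {m} {n} i j eq =
  trans (sym (funToFin-finToFin {n} {m} i)) (trans (funToFin-cong eq) (funToFin-finToFin {n} {m} j))

module Pullback (T : Graph) {N : ℕ} (base : Fin N → Fin (size T)) where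

  graph : Graph
  graph = record
    { size = N
    ; adj = λ u v → adj T (base u) (base v)
    ; sym = λ u v → Graph.sym T (base u) (base v)
    ; irrefl = λ u → irrefl T (base u) }

  module _ (σ : Fin (size T) → Fin N) where

    inImage : Fin N → Bool
    inImage u = does (σ (base u) ≟ u)

    image : Subgraph graph
    image = record
      { vs = tabulate inImage
      ; es = λ u v → (inImage u ∧ inImage v) ∧ adj T (base u) (base v)
      ; es-sym = λ u v → cong₂ _∧_ (∧-comm (inImage u) (inImage v)) (Graph.sym T (base u) (base v))
      ; es⊆E = λ u v → ∧-conicalʳ _ _
      ; es-end = λ u v uv → ∈-tabulate⁺ (∧-conicalˡ _ _ (∧-conicalˡ _ _ uv)) }

  module _ {σ : Fin (size T) → Fin N} (section : ∀ x → base (σ x) ≡ x) where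

    σ∈image : ∀ x → inImage σ (σ x) ≡ true
    σ∈image x = dec-true (σ (base (σ x)) ≟ σ x) (cong σ (section x))

    image-iso : IsomorphicTo T (image σ)
    image-iso = σ , σ-injective , (λ x → ∈-tabulate⁺ (σ∈image x)) , onto , edges
      where
      σ-injective : ∀ x y → σ x ≡ σ y → x ≡ y
      σ-injective x y σx≡σy = trans (sym (section x)) (trans (cong base σx≡σy) (section y))
      onto : ∀ v → v ∈ tabulate (inImage σ) → ∃[ x ] σ x ≡ v
      onto v v∈image = base v , does⇒ (σ (base v) ≟ v) (∈-tabulate⁻ v∈image)
      edges : ∀ x y → adj T x y ≡ Subgraph.es (image σ) (σ x) (σ y)
      edges x y rewrite σ∈image x | σ∈image y | section x | section y = refl

  image-injective : ∀ {σ σ′} → (∀ x → base (σ x) ≡ x) →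
    SameSubgraph (image σ) (image σ′) → ∀ x → σ x ≡ σ′ x
  image-injective {σ} {σ′} section (same-vs , _) x = begin
    σ x               ≡⟨ does⇒ (σ′ (base (σ x)) ≟ σ x) (∈-tabulate⁻ σx∈image′) ⟨
    σ′ (base (σ x))   ≡⟨ cong σ′ (section x) ⟩
    σ′ x              ∎
    where
    open ≡-Reasoning
    σx∈image′ : σ x ∈ tabulate (inImage σ′)
    σx∈image′ = subst (σ x ∈_) same-vs (∈-tabulate⁺ (σ∈image section x))

-- The blow-up of T at a stable set

^-distrib-* : ∀ a b k → (a * b) ^ k ≡ a ^ k * b ^ k
^-distrib-* a b zero = refl
^-distrib-* a b (suc k) = begin-equality
  a * b * (a * b) ^ k      ≡⟨ cong (a * b *_) (^-distrib-* a b k) ⟩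
  a * b * (a ^ k * b ^ k)  ≡⟨ [m*n]*[o*p]≡[m*o]*[n*p] a b (a ^ k) (b ^ k) ⟩
  a ^ suc k * b ^ suc k    ∎
  where open ≤-Reasoning

blowUpFactor : ∀ t k n → t + t ≤ n → ∃[ c ] (t + k * c ≤ n × n ^ k ≤ suc c ^ k * (2 * k) ^ k)
blowUpFactor t zero n 2t≤n = 0 , ≤-trans (+-monoʳ-≤ t z≤n) 2t≤n , ≤-refl
blowUpFactor t k@(suc _) n 2t≤n = c , size≤n , n^k≤
  where
  d = n ∸ t
  c = d / k
  t+d≡n : t + d ≡ n
  t+d≡n = m+[n∸m]≡n (m+n≤o⇒m≤o t 2t≤n)
  size≤n : t + k * c ≤ n
  size≤n = begin
    t + k * c  ≡⟨ cong (t +_) (*-comm k c) ⟩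
    t + c * k  ≤⟨ +-monoʳ-≤ t (m/n*n≤m d k) ⟩
    t + d      ≡⟨ t+d≡n ⟩
    n          ∎
    where open ≤-Reasoning
  d≤[1+c]*k : d ≤ suc c * k
  d≤[1+c]*k = begin
    d              ≡⟨ m≡m%n+[m/n]*n d k ⟩
    d % k + c * k  ≤⟨ +-monoˡ-≤ (c * k) (<⇒≤ (m%n<n d k)) ⟩
    k + c * k      ∎
    where open ≤-Reasoning
  n≤[1+c]*2k : n ≤ suc c * (2 * k)
  n≤[1+c]*2k = begin
    n                             ≡⟨ sym t+d≡n ⟩
    t + d                         ≤⟨ +-monoˡ-≤ d (m+n≤o⇒m≤o∸n t 2t≤n) ⟩
    d + d                         ≤⟨ +-mono-≤ d≤[1+c]*k d≤[1+c]*k ⟩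
    suc c * k + suc c * k         ≡⟨ sym (*-distribˡ-+ (suc c) k k) ⟩
    suc c * (k + k)               ≡⟨ cong (λ x → suc c * (k + x)) (sym (+-identityʳ k)) ⟩
    suc c * (2 * k)               ∎
    where open ≤-Reasoning
  n^k≤ : n ^ k ≤ suc c ^ k * (2 * k) ^ k
  n^k≤ = ≤-trans (^-monoˡ-≤ k n≤[1+c]*2k) (≤-reflexive (^-distrib-* (suc c) (2 * k) k))

module BlowUp (T : Graph) {k : ℕ} (e : Fin k → Fin (size T))
              (e-injective : ∀ {a b} → e a ≡ e b → a ≡ b) (c : ℕ) where

  private
    t : ℕ
    t = size T

  -- Vertices: orig x for x in T, then twin a j (j < c), the extra copies of e a.
  orig : Fin t → Fin (t + k * c)
  orig x = x ↑ˡ (k * c)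

  twin : Fin k → Fin c → Fin (t + k * c)
  twin a j = t ↑ʳ combine a j

  caseVertex : ∀ {A : Set} → (Fin t → A) → (Fin k → Fin c → A) → Fin (t + k * c) → A
  caseVertex f g u = [ f , uncurry g ∘ remQuot c ]′ (splitAt t u)

  caseVertex-orig : ∀ {A : Set} (f : Fin t → A) g x → caseVertex f g (orig x) ≡ f x
  caseVertex-orig f g x rewrite splitAt-↑ˡ t x (k * c) = refl

  caseVertex-twin : ∀ {A : Set} f (g : Fin k → Fin c → A) a j → caseVertex f g (twin a j) ≡ g a j
  caseVertex-twin f g a j rewrite splitAt-↑ʳ t (k * c) (combine a j) =
    cong (uncurry g) (remQuot-combine {k} {c} a j)

  data VertexView : Fin (t + k * c) → Set where
    orig-view : ∀ x → VertexView (orig x)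
    twin-view : ∀ a j → VertexView (twin a j)

  vertexView : ∀ u → VertexView u
  vertexView u with splitAt t u in u≡
  ... | inj₁ x = subst VertexView (splitAt⁻¹-↑ˡ u≡) (orig-view x)
  ... | inj₂ q = subst VertexView (trans (cong (t ↑ʳ_) (combine-remQuot {k} c q)) (splitAt⁻¹-↑ʳ u≡))
                   (twin-view _ _)

  orig≢twin : ∀ x a j → orig x ≢ twin a j
  orig≢twin x a j eq = contradiction splits (λ ())
    where
    open ≡-Reasoning
    splits : inj₁ x ≡ inj₂ (combine a j)
    splits = begin
      inj₁ x                 ≡⟨ splitAt-↑ˡ t x (k * c) ⟨
      splitAt t (orig x)     ≡⟨ cong (splitAt t) eq ⟩
      splitAt t (twin a j)   ≡⟨ splitAt-↑ʳ t (k * c) (combine a j) ⟩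
      inj₂ (combine a j)     ∎

  base : Fin (t + k * c) → Fin t
  base = caseVertex id (λ a _ → e a)

  base-orig : ∀ x → base (orig x) ≡ x
  base-orig = caseVertex-orig id (λ a _ → e a)

  base-twin : ∀ a j → base (twin a j) ≡ e a
  base-twin = caseVertex-twin id (λ a _ → e a)

  open Pullback T base public

  preimage : Fin t → Maybe (Fin k)
  preimage x with any? (λ a → e a ≟ x)
  ... | yes (a , _) = just a
  ... | no _ = nothing

  preimage-e : ∀ a → preimage (e a) ≡ just a
  preimage-e a with any? (λ b → e b ≟ e a)
  ... | yes (b , eb≡ea) = cong just (e-injective eb≡ea)
  ... | no none = contradiction (a , refl) none

  preimage-just : ∀ {x a} → preimage x ≡ just a → e a ≡ x
  preimage-just {x} px with any? (λ b → e b ≟ x)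
  preimage-just refl | yes (b , eb≡x) = eb≡x

  preimage-view : ∀ x → (∃[ a ] preimage x ≡ just a) ⊎ preimage x ≡ nothing
  preimage-view x with preimage x
  ... | just a = inj₁ (a , refl)
  ... | nothing = inj₂ refl

  pick : Fin t → Fin k → Fin (suc c) → Fin (t + k * c)
  pick x a zero = orig x
  pick x a (suc j) = twin a j

  pick-injective : ∀ x a {i i′} → pick x a i ≡ pick x a i′ → i ≡ i′
  pick-injective x a {zero} {zero} _ = refl
  pick-injective x a {zero} {suc j} eq = contradiction eq (orig≢twin x a j)
  pick-injective x a {suc i} {zero} eq = contradiction (sym eq) (orig≢twin x a i)
  pick-injective x a {suc i} {suc j} eq = cong suc (combine-injectiveʳ a i a j (↑ʳ-injective t _ _ eq))

  section : (Fin k → Fin (suc c)) → Fin t → Fin (t + k * c)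
  section τ x = maybe′ (λ a → pick x a (τ a)) (orig x) (preimage x)

  section-base : ∀ τ x → base (section τ x) ≡ x
  section-base τ x with preimage x in px
  ... | nothing = base-orig x
  ... | just a with τ a
  ...   | zero = base-orig x
  ...   | suc j = trans (base-twin a j) (preimage-just px)

  section-e : ∀ τ a → section τ (e a) ≡ pick (e a) a (τ a)
  section-e τ a rewrite preimage-e a = refl

  copies : CountAtLeast (suc c ^ k) T graph
  copies = (λ i → image (section (finToFun i)))
         , (λ i → image-iso (section-base (finToFun i)))
         , distinct
    where
    distinct : ∀ i j → SameSubgraph (image (section (finToFun i))) (image (section (finToFun j))) → i ≡ j
    distinct i j same = finToFun-injective i j λ a → pick-injective (e a) a
      (trans (sym (section-e (finToFun i) a))
        (trans (image-injective {σ′ = section (finToFun j)} (section-base (finToFun i)) same (e a))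
          (section-e (finToFun j) a)))

  module _ {s : ℕ} (1≤s : 1 ≤ s) (R : Rooting T ⊤ t)
           (e-degree : ∀ a → degree T (e a) ≤ s) (e-stable : ∀ a b → adj T (e a) (e b) ≡ false) where

    open Rooting R

    origParent : Fin t → Fin (suc (t + k * c))
    origParent x = maybe′ (suc ∘ orig) zero (parent x)

    twinParent : Fin k → Fin c → Fin (suc (t + k * c))
    twinParent a _ = suc (orig (e a))

    nodeParent : Fin (t + k * c) → Fin (suc (t + k * c))
    nodeParent = caseVertex origParent twinParent

    twinRank : Fin k → Fin c → ℕ
    twinRank a _ = suc (suc (rank (e a)))

    nodeRank : Fin (suc (t + k * c)) → ℕ
    nodeRank zero = 0
    nodeRank (suc u) = caseVertex (suc ∘ rank) twinRank u

    nodeParent-orig : ∀ {x m} → parent x ≡ m → nodeParent (orig x) ≡ maybe′ (suc ∘ orig) zero m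
    nodeParent-orig {x} x↑ =
      trans (caseVertex-orig origParent twinParent x) (cong (maybe′ (suc ∘ orig) zero) x↑)

    nodeParent-twin : ∀ a j → nodeParent (twin a j) ≡ suc (orig (e a))
    nodeParent-twin = caseVertex-twin origParent twinParent

    nodeRank-orig : ∀ x → nodeRank (suc (orig x)) ≡ suc (rank x)
    nodeRank-orig = caseVertex-orig (suc ∘ rank) twinRank

    nodeRank-twin : ∀ a j → nodeRank (suc (twin a j)) ≡ suc (suc (rank (e a)))
    nodeRank-twin = caseVertex-twin (suc ∘ rank) twinRank

    nodeParent-rank : ∀ u → nodeRank (nodeParent u) < nodeRank (suc u)
    nodeParent-rank u with vertexView u
    ... | twin-view a j = subst₂ _<_ (sym (trans (cong nodeRank (nodeParent-twin a j)) (nodeRank-orig (e a))))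
                                     (sym (nodeRank-twin a j)) ≤-refl
    ... | orig-view x with parent x in x↑
    ...   | nothing =
      subst₂ _<_ (sym (cong nodeRank (nodeParent-orig x↑))) (sym (nodeRank-orig x)) (s≤s z≤n)
    ...   | just y = subst₂ _<_ (sym (trans (cong nodeRank (nodeParent-orig x↑)) (nodeRank-orig y)))
                                 (sym (nodeRank-orig x)) (s≤s (parent-rank ∈⊤ x↑))

    open ParentTree nodeParent nodeRank nodeParent-rank

    lift : Subset t → Subset (t + k * c)
    lift p = p ++ ⊥

    parentBag : Fin t → Subset (t + k * c)
    parentBag x = maybe′ (⁅_⁆ ∘ orig) ⊥ (parent x)

    baseBag : Fin t → Subset (t + k * c)
    baseBag x = maybe′ (λ _ → lift (nbhd T x)) (parentBag x) (preimage x)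

    extra : Fin (t + k * c) → Subset (t + k * c)
    extra = baseBag ∘ base

    baseBag-just : ∀ {x a} → preimage x ≡ just a → baseBag x ≡ lift (nbhd T x)
    baseBag-just px rewrite px = refl

    baseBag-nothing : ∀ {x} → preimage x ≡ nothing → baseBag x ≡ parentBag x
    baseBag-nothing px rewrite px = refl

    baseBag-size : ∀ x → ∣ baseBag x ∣ ≤ s
    baseBag-size x with preimage x in px
    ... | just a =
      ≤-trans (≤-reflexive ∣lift∣≡deg) (subst (λ y → degree T y ≤ s) (preimage-just px) (e-degree a))
      where
      ∣lift∣≡deg : ∣ lift (nbhd T x) ∣ ≡ degree T x
      ∣lift∣≡deg = trans (∣p++q∣≡∣p∣+∣q∣ (nbhd T x) ⊥)
                         (trans (cong (degree T x +_) (∣⊥∣≡0 (k * c))) (+-identityʳ _))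
    ... | nothing with parent x
    ...   | just y = subst (_≤ s) (sym (∣⁅x⁆∣≡1 (orig y))) 1≤s
    ...   | nothing = subst (_≤ s) (sym (∣⊥∣≡0 (t + k * c))) z≤n

    extra-orig : ∀ x → extra (orig x) ≡ baseBag x
    extra-orig x = cong baseBag (base-orig x)

    extra-twin : ∀ a j → extra (twin a j) ≡ baseBag (e a)
    extra-twin a j = cong baseBag (base-twin a j)

    nbhd∈baseBag : ∀ {x y a} → preimage x ≡ just a → Adj T x y → orig y ∈ baseBag x
    nbhd∈baseBag px xy = subst (_ ∈_) (sym (baseBag-just px)) (∈-++⁺ˡ ⊥ (∈-tabulate⁺ xy))

    parent∈baseBag : ∀ {x y} → preimage x ≡ nothing → parent x ≡ just y → orig y ∈ baseBag x
    parent∈baseBag {x} {y} px py rewrite baseBag-nothing px | py = x∈⁅x⁆ (orig y)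

    baseBag-just⁻ : ∀ {x v a} → preimage x ≡ just a → v ∈ baseBag x → ∃[ y ] (v ≡ orig y × Adj T x y)
    baseBag-just⁻ {x} {v} px v∈ with vertexView v | subst (v ∈_) (baseBag-just px) v∈
    ... | orig-view y | y∈ = y , refl , ∈-tabulate⁻ (∈-++⁻ˡ (nbhd T x) y∈)
    ... | twin-view a j | tw∈ = contradiction tw∈ (↑ʳ∉p++⊥ (nbhd T x) (combine a j))

    ¬Adj-e : ∀ a b → ¬ Adj T (e a) (e b)
    ¬Adj-e a b ab with () ← trans (sym ab) (e-stable a b)

    extra-edge : ∀ {u v} → Adj graph u v → v ∈ extra u ⊎ u ∈ extra v
    extra-edge {u} {v} uv with vertexView u | vertexView v
    ... | twin-view a i | twin-view b j =
      contradiction (subst₂ (Adj T) (base-twin a i) (base-twin b j) uv) (¬Adj-e a b)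
    ... | twin-view a i | orig-view y = inj₁ (subst (_ ∈_) (sym (extra-twin a i))
      (nbhd∈baseBag (preimage-e a) (subst₂ (Adj T) (base-twin a i) (base-orig y) uv)))
    ... | orig-view x | twin-view b j = inj₂ (subst (_ ∈_) (sym (extra-twin b j))
      (nbhd∈baseBag (preimage-e b) (subst₂ (Adj T) (base-twin b j) (base-orig x) (Adj-sym T uv))))
    ... | orig-view x | orig-view y =
      map-⊎ (subst (_ ∈_) (sym (extra-orig x))) (subst (_ ∈_) (sym (extra-orig y))) (origEdge xy)
      where
      xy : Adj T x y
      xy = subst₂ (Adj T) (base-orig x) (base-orig y) uv
      origEdge : ∀ {x y} → Adj T x y → orig y ∈ baseBag x ⊎ orig x ∈ baseBag y
      origEdge {x} {y} xy with preimage-view x | preimage-view y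
      ... | inj₁ (a , px) | _ = inj₁ (nbhd∈baseBag px xy)
      ... | inj₂ px | inj₁ (b , py) = inj₂ (nbhd∈baseBag py (Adj-sym T xy))
      ... | inj₂ px | inj₂ py with edge-parent ∈⊤ ∈⊤ xy
      ...   | inj₁ x↑≡y = inj₁ (parent∈baseBag px x↑≡y)
      ...   | inj₂ y↑≡x = inj₂ (parent∈baseBag py y↑≡x)

    origLink : ∀ {x y} → Adj T x y → Adj tree (suc (orig x)) (suc (orig y))
    origLink {x} {y} xy with edge-parent ∈⊤ ∈⊤ xy
    ... | inj₁ x↑≡y = parent-adj (nodeParent-orig x↑≡y)
    ... | inj₂ y↑≡x = Adj-sym tree {suc (orig y)} (parent-adj (nodeParent-orig y↑≡x))

    origHop : ∀ {x y a} → preimage x ≡ just a → Adj T x y →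
      Path tree (InStarBag extra (orig y)) (suc (orig x)) (suc (orig y))
    origHop {x} px xy =
      extra∈starBag extra (subst (_ ∈_) (sym (extra-orig x)) (nbhd∈baseBag px xy)) ∷⟨ origLink xy ⟩
      [ centre∈starBag extra _ ]

    extra-path : ∀ {u v} → v ∈ extra u → Path tree (InStarBag extra v) (suc u) (suc v)
    extra-path {u} {v} v∈ with vertexView u
    ... | twin-view a j with baseBag-just⁻ (preimage-e a) (subst (v ∈_) (extra-twin a j) v∈)
    ...   | y , refl , ea-y =
      extra∈starBag extra v∈ ∷⟨ parent-adj (nodeParent-twin a j) ⟩
      origHop (preimage-e a) ea-y
    extra-path {u} {v} v∈ | orig-view x with preimage-view x
    ... | inj₁ (a , px) with baseBag-just⁻ px (subst (v ∈_) (extra-orig x) v∈)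
    ...   | y , refl , xy = origHop px xy
    extra-path {u} {v} v∈ | orig-view x | inj₂ px
      with parent x in x↑ | subst (v ∈_) (trans (extra-orig x) (baseBag-nothing px)) v∈
    ... | nothing | v∈⊥ = contradiction v∈⊥ ∉⊥
    ... | just y | v∈⁅y⁆ rewrite x∈⁅y⁆⇒x≡y (orig y) v∈⁅y⁆ =
      extra∈starBag extra v∈ ∷⟨ parent-adj (nodeParent-orig x↑) ⟩ [ centre∈starBag extra _ ]

    decomposition : TreeDecomposition graph s
    decomposition = starDecomposition nodeParent nodeRank nodeParent-rank extra
      (λ u → baseBag-size (base u)) extra-edge extra-path

lemma3 : (s : ℕ) → 1 ≤ s → (T : Graph) → IsForest T → (k : ℕ) → AlphaIs s T k →
    ∃[ N ] (∀ n → N ≤ n →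
      ∃[ G ] (size G ≤ n × TreewidthAtMost G s ×
        ∃[ m ] (n ^ k ≤ m * (2 * k) ^ k × CountAtLeast m T G)))
lemma3 s 1≤s T forest k ((S , (lowDegree , stable) , refl) , _) = size T + size T , λ n 2t≤n →
  let c , t+kc≤n , n^k≤ = blowUpFactor (size T) k n 2t≤n
      open BlowUp T (enumerate S) (enumerate-injective S) c
  in graph , t+kc≤n , decomposition 1≤s R (λ a → lowDegree _ (enumerate-∈ S a))
       (λ a b → stable _ _ (enumerate-∈ S a) (enumerate-∈ S b)) ,
     suc c ^ k , n^k≤ , copies
  where
  R : Rooting T ⊤ (size T)
  R = rooting forest (size T) ⊤ (≤-reflexive (∣⊤∣≡n (size T)))
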